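{- (1) The dual lattice $L_{ns}^\vee=\{x\in V:\beta(x,y)\in\mathbb{Z}\ \forall y\in L_{ns}\}$ equals $L\cap M_{ns}$. (2) The lattices $L_{ns}$ and $L_{ns}^\vee$ are invariant under the conjugation action of $\Gamma^+_{ns}$, and $\Gamma_{ns}$ acts trivially on $L_{ns}^\vee/L_{ns}$. (3) The discriminant form $(L_{ns}^\vee/L_{ns},\beta \bmod \mathbb{Z})$ is isomorphic to $\mathbb{Z}/2p^2$ with the quadratic form $s\mapsto \varepsilon' s^2/(4p^2)\bmod \mathbb{Z}$, where $\varepsilon'$ is an inverse of $\varepsilon$ modulo $4p^2$.
   Context: Let $p$ be an odd prime and $\varepsilon$ an integer that is not a square modulo $p$ with $\varepsilon\equiv 1\pmod 4$. Let $M_{ns}=\{\left(\begin{smallmatrix} a&b\\ c&d\end{smallmatrix}\right)\in M_2(\mathbb{Z}): a\equiv d,\ b\varepsilon\equiv c\pmod p\}$, $M_{ns}^+=M_{ns}\cup\{\left(\begin{smallmatrix} a&b\\ c&d\end{smallmatrix}\right)\in M_2(\mathbb{Z}): a\equiv -d,\ b\varepsilon\equiv -c\pmod p\}$, $\Gamma_{ns}=M_{ns}\cap\mathrm{SL}_2(\mathbb{Z})$, $\Gamma^+_{ns}=M^+_{ns}\cap\mathrm{SL}_2(\mathbb{Z})$. Let $V=\{x\in M_2(\mathbb{Q}):\mathrm{Tr}\,x=0\}$ with the symmetric bilinear form $\beta(x,y)=-\mathrm{Tr}(x\,\mathrm{adj}(y))/(4p^2)$ (adj = adjugate matrix) and $\beta(x)=\beta(x,x)/2$.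 Let $L=\{\left(\begin{smallmatrix} B&2C\\ -2A&-B\end{smallmatrix}\right):A,B,C\in\mathbb{Z}\}$ and $L_{ns}=\{\left(\begin{smallmatrix} B&2C\\ -2A&-B\end{smallmatrix}\right)\in L: A\equiv B\equiv C\equiv 0\pmod p,\ B\equiv 0\pmod 2,\ A\equiv\varepsilon C\pmod{p^2}\}$, an even lattice. $\Gamma^+_{ns}$ acts on $V$ by conjugation. -}

module Defs where

open import Data.Nat as ℕ using (ℕ; zero; suc)
open import Data.Integer as ℤ using (ℤ; +_)
open import Data.Integer.Divisibility using () renaming (_∣_ to _∣ℤ_)
open import Data.Rational as ℚ using (ℚ; 0ℚ; _/_)
open import Data.Product using (Σ; ∃; ∃-syntax; _×_; _,_)
open import Data.Sum using (_⊎_)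
open import Relation.Binary.PropositionalEquality using (_≡_)

record M2 (A : Set) : Set where
  constructor mat
  field
    a b c d : A
open M2 public

infix 4 _≡_[mod_]
_≡_[mod_] : ℤ → ℤ → ℕ → Set
x ≡ y [mod n ] = (+ n) ∣ℤ (x ℤ.- y)

detℤ : M2 ℤ → ℤ
detℤ m = (a m ℤ.* d m) ℤ.- (b m ℤ.* c m)

InMns : ℕ → ℤ → M2 ℤ → Set
InMns p ε m = (a m ≡ d m [mod p ]) × (b m ℤ.* ε ≡ c m [mod p ])

InMns⁺ : ℕ → ℤ → M2 ℤ → Set
InMns⁺ p ε m = InMns p ε m
             ⊎ ((a m ≡ ℤ.- d m [mod p ]) × (b m ℤ.* ε ≡ ℤ.- c m [mod p ]))

InΓns : ℕ → ℤ → M2 ℤ → Set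
InΓns p ε m = InMns p ε m × (detℤ m ≡ ℤ.1ℤ)

InΓns⁺ : ℕ → ℤ → M2 ℤ → Set
InΓns⁺ p ε m = InMns⁺ p ε m × (detℤ m ≡ ℤ.1ℤ)

ℤ→ℚ : ℤ → ℚ
ℤ→ℚ z = z / 1

toℚM : M2 ℤ → M2 ℚ
toℚM m = mat (ℤ→ℚ (a m)) (ℤ→ℚ (b m)) (ℤ→ℚ (c m)) (ℤ→ℚ (d m))

_·_ : M2 ℚ → M2 ℚ → M2 ℚ
x · y = mat (a x ℚ.* a y ℚ.+ b x ℚ.* c y) (a x ℚ.* b y ℚ.+ b x ℚ.* d y)
            (c x ℚ.* a y ℚ.+ d x ℚ.* c y) (c x ℚ.* b y ℚ.+ d x ℚ.* d y)

_⊖_ : M2 ℚ → M2 ℚ → M2 ℚ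
x ⊖ y = mat (a x ℚ.- a y) (b x ℚ.- b y) (c x ℚ.- c y) (d x ℚ.- d y)

tr : M2 ℚ → ℚ
tr x = a x ℚ.+ d x

adj : M2 ℚ → M2 ℚ
adj x = mat (d x) (ℚ.- b x) (ℚ.- c x) (a x)

-- conjugation action  γ · x · γ⁻¹  of γ ∈ SL₂(ℤ) (γ⁻¹ = adj γ since det γ = 1)
conj : M2 ℤ → M2 ℚ → M2 ℚ
conj γ x = (toℚM γ · x) · adj (toℚM γ)

InV : M2 ℚ → Set
InV x = tr x ≡ 0ℚ

-- z / (4 p²) as a rational (p is a prime below, so p ≠ 0; p = 0 is a junk case)
over4p² : ℕ → ℤ → ℚ
over4p² zero    z = 0ℚ
over4p² (suc k) z = z / (4 ℕ.* (suc k ℕ.* suc k))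

β : ℕ → M2 ℚ → M2 ℚ → ℚ
β p x y = ℚ.- (tr (x · adj y) ℚ.* over4p² p ℤ.1ℤ)

β₁ : ℕ → M2 ℚ → ℚ
β₁ p x = β p x x ℚ.* (ℤ.1ℤ / 2)

IsInt : ℚ → Set
IsInt q = ∃[ z ] q ≡ ℤ→ℚ z

Lmat : ℤ → ℤ → ℤ → M2 ℤ
Lmat A B C = mat B (+ 2 ℤ.* C) (ℤ.- (+ 2 ℤ.* A)) (ℤ.- B)

InL : M2 ℚ → Set
InL x = ∃[ A ] ∃[ B ] ∃[ C ] x ≡ toℚM (Lmat A B C)

InLns : ℕ → ℤ → M2 ℚ → Set
InLns p ε x = ∃[ A ] ∃[ B ] ∃[ C ] (x ≡ toℚM (Lmat A B C))
  × (A ≡ ℤ.0ℤ [mod p ]) × (B ≡ ℤ.0ℤ [mod p ]) × (C ≡ ℤ.0ℤ [mod p ])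
  × (B ≡ ℤ.0ℤ [mod 2 ]) × (A ≡ ε ℤ.* C [mod (p ℕ.* p) ])

InL∩Mns : ℕ → ℤ → M2 ℚ → Set
InL∩Mns p ε x = ∃[ A ] ∃[ B ] ∃[ C ] (x ≡ toℚM (Lmat A B C)) × InMns p ε (Lmat A B C)

InDual : ℕ → ℤ → M2 ℚ → Set
InDual p ε x = InV x × (∀ y → InLns p ε y → IsInt (β p x y))

module Submission where

-- Everything is reduced to integer coordinates: ⟨ A , B , C ⟩ stands for the matrix ( B 2C ; −2A −B )
-- of L; membership in L_ns and in L ∩ M_ns become the divisibility conditions IsLns and IsLMns;
-- conjugation by an integer matrix becomes an explicit quadratic map conjᶜ on coordinates; and β, β₁
-- on L become integer forms divided by 4p².  Only the oddness of p and ε ≡ 1 (mod 4) are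
-- used.

open import Defs
open import Data.Nat using (ℕ) renaming (_*_ to _*ℕ_)
open import Data.Nat.Primality using (Prime)
open import Data.Integer using (ℤ; _*_; _+_; 0ℤ; 1ℤ)
open import Data.Rational using (ℚ) renaming (_-_ to _-ℚ_)
open import Data.Product using (Σ; ∃; ∃-syntax; _×_)
open import Function.Bundles using (_⇔_; mk⇔)
open import Relation.Nullary using (¬_)
open import Relation.Binary.PropositionalEquality using (_≢_)

open import Data.Nat as ℕ using (zero; suc)
import Data.Nat.Properties as ℕP
import Data.Nat.Primality as Primality
import Data.Nat.Divisibility as ℕD
open import Data.Nat.Coprimality as ℕC using (Coprime)
open import Data.Nat.DivMod using (m≡m%n+[m/n]*n; m%n<n)
open import Data.Integer as ℤ using (+_; -_; _-_)
import Data.Integer.Properties as ℤP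
open import Data.Integer.Divisibility.Signed
  using (_∣_; divides; ∣ᵤ⇒∣; ∣⇒∣ᵤ; ∣-refl; ∣-reflexive; ∣m∣n⇒∣m+n; ∣m∣n⇒∣m-n; ∣m⇒∣-m; ∣n⇒∣m*n; ∣m⇒∣m*n;
         *-monoʳ-∣; *-monoˡ-∣; ∣-trans; module ∣-Reasoning)
open import Data.Integer.Tactic.RingSolver using (solve-∀)
open import Data.Product using (_,_; proj₁; proj₂)
open import Data.Sum using (inj₁; inj₂)
open import Data.Empty using (⊥-elim)
open import Data.Rational as ℚ using (mkℚ; 0ℚ; 1ℚ)
import Data.Rational.Properties as ℚP
open import Data.Rational.Unnormalised as ℚᵘ using (mkℚᵘ; *≡*)
import Data.Rational.Unnormalised.Properties as ℚᵘP
open import Data.Rational.Solver using (module +-*-Solver)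
open import Relation.Binary.PropositionalEquality
  using (_≡_; refl; sym; trans; cong; cong₂; subst; module ≡-Reasoning)

mod⇒∣ : ∀ {x y n} → x ≡ y [mod n ] → + n ∣ x - y
mod⇒∣ = ∣ᵤ⇒∣

∣⇒mod : ∀ {x y n} → + n ∣ x - y → x ≡ y [mod n ]
∣⇒mod = ∣⇒∣ᵤ

∣0⇒mod : ∀ {x n} → + n ∣ x → x ≡ 0ℤ [mod n ]
∣0⇒mod {x} {n} h = ∣⇒mod {x} {0ℤ} {n} (subst (_ ∣_) (sym (ℤP.+-identityʳ x)) h)

mod0⇒∣ : ∀ {x n} → x ≡ 0ℤ [mod n ] → + n ∣ x
mod0⇒∣ {x} {n} h = subst (_ ∣_) (ℤP.+-identityʳ x) (mod⇒∣ {x} {0ℤ} {n} h)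

∣-* : ∀ {k l x y} → k ∣ x → l ∣ y → k * l ∣ x * y
∣-* {k} {l} {x} {y} k∣x l∣y = ∣-trans (*-monoˡ-∣ l k∣x) (*-monoʳ-∣ x l∣y)

∣-lin : ∀ {k x y} m n → k ∣ x → k ∣ y → k ∣ m * x + n * y
∣-lin m n k∣x k∣y = ∣m∣n⇒∣m+n (∣n⇒∣m*n m k∣x) (∣n⇒∣m*n n k∣y)

k∣0 : ∀ {k} → k ∣ 0ℤ
k∣0 {k} = divides 0ℤ (sym (ℤP.*-zeroˡ k))

∣-≡ : ∀ {k x y} → x ≡ y → k ∣ x - y
∣-≡ {k} {x} refl = divides 0ℤ (trans (ℤP.+-inverseʳ x) (sym (ℤP.*-zeroˡ k)))

Odd : ℤ → Set
Odd n = ∃[ r ] n ≡ + 2 * r + 1ℤ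

-- For n = 2r+1, division by 2 is possible modulo n: (r+1)·2 ≡ 1 (mod n).
∣2*⇒∣ : ∀ {n x} → Odd n → n ∣ + 2 * x → n ∣ x
∣2*⇒∣ {n} {x} (r , refl) n∣2x = begin
  n                         ∣⟨ ∣m∣n⇒∣m-n (∣n⇒∣m*n (r + 1ℤ) n∣2x) (∣n⇒∣m*n x ∣-refl) ⟩
  (r + 1ℤ) * (+ 2 * x) - x * n ≡⟨ halve r x ⟩
  x                         ∎
  where
  open ∣-Reasoning
  halve : ∀ r x → (r + 1ℤ) * (+ 2 * x) - x * (+ 2 * r + 1ℤ) ≡ x
  halve = solve-∀

2∣*⇒2∣ : ∀ {n x} → Odd n → + 2 ∣ n * x → + 2 ∣ x
2∣*⇒2∣ {n} {x} (r , refl) 2∣nx = begin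
  + 2                    ∣⟨ ∣m∣n⇒∣m-n 2∣nx (∣n⇒∣m*n (r * x) ∣-refl) ⟩
  n * x - r * x * + 2    ≡⟨ drop-even r x ⟩
  x                      ∎
  where
  open ∣-Reasoning
  drop-even : ∀ r x → (+ 2 * r + 1ℤ) * x - r * x * + 2 ≡ x
  drop-even = solve-∀

2∣∧∣⇒2*∣ : ∀ {n x} → Odd n → + 2 ∣ x → n ∣ x → + 2 * n ∣ x
2∣∧∣⇒2*∣ {n} {x} n-odd 2∣x (divides q refl) with 2∣*⇒2∣ n-odd (subst (+ 2 ∣_) (ℤP.*-comm q n) 2∣x)
... | divides q' refl = divides q' (ℤP.*-assoc q' (+ 2) n)

odd² : ∀ {n} → Odd n → Odd (n * n)
odd² (r , refl) = + 2 * r * (r + 1ℤ) , square r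
  where
  square : ∀ r → (+ 2 * r + 1ℤ) * (+ 2 * r + 1ℤ) ≡ + 2 * (+ 2 * r * (r + 1ℤ)) + 1ℤ
  square = solve-∀

oddPrime⇒odd : ∀ {p} → Prime p → p ≢ 2 → Odd (+ p)
oddPrime⇒odd {p} pr p≢2 = go (p ℕ.% 2) (m%n<n p 2) (m≡m%n+[m/n]*n p 2)
  where
  q = p ℕ./ 2
  reorder : ∀ x → 1ℤ + x * + 2 ≡ + 2 * x + 1ℤ
  reorder = solve-∀
  go : ∀ k → k ℕ.< 2 → p ≡ k ℕ.+ q *ℕ 2 → Odd (+ p)
  go zero _ p≡2q with Primality.prime⇒irreducible pr (ℕD.divides q p≡2q)
  ... | inj₁ ()
  ... | inj₂ 2≡p = ⊥-elim (p≢2 (sym 2≡p))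
  go (suc zero) _ p≡2q+1 = + q , (begin
    + p                ≡⟨ cong +_ p≡2q+1 ⟩
    + (1 ℕ.+ q *ℕ 2)   ≡⟨ ℤP.pos-+ 1 (q *ℕ 2) ⟩
    1ℤ + + (q *ℕ 2)    ≡⟨ cong (λ y → 1ℤ + y) (ℤP.pos-* q 2) ⟩
    1ℤ + + q * + 2     ≡⟨ reorder (+ q) ⟩
    + 2 * + q + 1ℤ     ∎)
    where open ≡-Reasoning
  go (suc (suc _)) (ℕ.s≤s (ℕ.s≤s ())) _

/1-coprime : ∀ z → Coprime ℤ.∣ z ∣ 1
/1-coprime z = ℕC.sym (ℕC.1-coprimeTo ℤ.∣ z ∣)

-- ℤ→ℚ z is the normalised fraction z/1; mkℚ z 0 is the same number built
-- directly, on which the arithmetic of ℚ computes.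
ℤ→ℚ≡mkℚ : ∀ z → ℤ→ℚ z ≡ mkℚ z 0 (/1-coprime z)
ℤ→ℚ≡mkℚ z = ℚP.↥p/↧p≡p (mkℚ z 0 (/1-coprime z))

ℤ→ℚ-* : ∀ x y → ℤ→ℚ (x * y) ≡ ℤ→ℚ x ℚ.* ℤ→ℚ y
ℤ→ℚ-* x y rewrite ℤ→ℚ≡mkℚ x | ℤ→ℚ≡mkℚ y = refl

ℤ→ℚ-+ : ∀ x y → ℤ→ℚ (x + y) ≡ ℤ→ℚ x ℚ.+ ℤ→ℚ y
ℤ→ℚ-+ x y rewrite ℤ→ℚ≡mkℚ x | ℤ→ℚ≡mkℚ y =
  sym (ℚP./-cong {x * 1ℤ + y * 1ℤ} {1} {x + y} {1}
         (cong₂ _+_ (ℤP.*-identityʳ x) (ℤP.*-identityʳ y)) refl)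

ℤ→ℚ-neg : ∀ x → ℤ→ℚ (- x) ≡ ℚ.- ℤ→ℚ x
ℤ→ℚ-neg x rewrite ℤ→ℚ≡mkℚ x | ℤ→ℚ≡mkℚ (- x) = negate x
  where
  negate : ∀ x → mkℚ (- x) 0 (/1-coprime (- x)) ≡ ℚ.- mkℚ x 0 (/1-coprime x)
  negate (+ zero)    = refl
  negate (+ suc n)   = refl
  negate ℤ.-[1+ n ]  = refl

ℤ→ℚ-sub : ∀ x y → ℤ→ℚ (x - y) ≡ ℤ→ℚ x ℚ.- ℤ→ℚ y
ℤ→ℚ-sub x y = trans (ℤ→ℚ-+ x (- y)) (cong (ℤ→ℚ x ℚ.+_) (ℤ→ℚ-neg y))

ℤ→ℚ-*+* : ∀ x y z w → ℤ→ℚ (x * y + z * w) ≡ ℤ→ℚ x ℚ.* ℤ→ℚ y ℚ.+ ℤ→ℚ z ℚ.* ℤ→ℚ w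
ℤ→ℚ-*+* x y z w = trans (ℤ→ℚ-+ (x * y) (z * w)) (cong₂ ℚ._+_ (ℤ→ℚ-* x y) (ℤ→ℚ-* z w))

ℤ→ℚ-injective : ∀ {x y} → ℤ→ℚ x ≡ ℤ→ℚ y → x ≡ y
ℤ→ℚ-injective {x} {y} eq = cong ℚ.↥_ (trans (sym (ℤ→ℚ≡mkℚ x)) (trans eq (ℤ→ℚ≡mkℚ y)))

/-as-* : ∀ z n .{{_ : ℕ.NonZero n}} → z ℚ./ n ≡ ℤ→ℚ z ℚ.* (1ℤ ℚ./ n)
/-as-* z (suc m) = ℚP.toℚᵘ-injective (ℚᵘP.≃-trans (ℚP.toℚᵘ-fromℚᵘ (mkℚᵘ z m))
  (ℚᵘP.≃-sym (ℚᵘP.≃-trans (ℚP.toℚᵘ-homo-* (ℤ→ℚ z) (1ℤ ℚ./ suc m))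
    (ℚᵘP.≃-trans (ℚᵘP.*-cong (ℚP.toℚᵘ-cong (ℤ→ℚ≡mkℚ z)) (ℚP.toℚᵘ-fromℚᵘ (mkℚᵘ 1ℤ m)))
      (*≡* (cong₂ _*_ (ℤP.*-identityʳ z) (cong (λ k → + suc k) (sym (ℕP.+-identityʳ m)))))))))

n*1/n≡1 : ∀ n .{{_ : ℕ.NonZero n}} → ℤ→ℚ (+ n) ℚ.* (1ℤ ℚ./ n) ≡ 1ℚ
n*1/n≡1 (suc m) = ℚP.toℚᵘ-injective (ℚᵘP.≃-trans (ℚP.toℚᵘ-homo-* (ℤ→ℚ (+ suc m)) (1ℤ ℚ./ suc m))
  (ℚᵘP.≃-trans (ℚᵘP.*-cong (ℚP.toℚᵘ-cong (ℤ→ℚ≡mkℚ (+ suc m))) (ℚP.toℚᵘ-fromℚᵘ (mkℚᵘ 1ℤ m)))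
    (*≡* (cong (λ k → + suc k) (trans (ℕP.*-identityʳ (m ℕ.* 1))
      (trans (ℕP.*-identityʳ m) (sym (trans (ℕP.+-identityʳ (m ℕ.+ 0)) (ℕP.+-identityʳ m)))))))))

open +-*-Solver using (solve; _:+_; _:*_; _:-_; :-_; _:=_; con)

-- The scale of the form β: on L, β and β₁ are integers times κ p = 1/(4p²).
κ : ℕ → ℚ
κ p = over4p² p 1ℤ

over4p²≡*κ : ∀ p .{{_ : ℕ.NonZero p}} z → over4p² p z ≡ ℤ→ℚ z ℚ.* κ p
over4p²≡*κ (suc k) z = /-as-* z (4 *ℕ (suc k *ℕ suc k))

4p²κ≡1 : ∀ p .{{_ : ℕ.NonZero p}} → ℤ→ℚ (+ 4 * (+ p * + p)) ℚ.* κ p ≡ 1ℚ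
4p²κ≡1 (suc k) = begin
  ℤ→ℚ (+ 4 * (+ suc k * + suc k)) ℚ.* κ (suc k)
    ≡⟨ cong (λ n → ℤ→ℚ n ℚ.* κ (suc k)) (sym (ℤP.pos-* 4 (suc k *ℕ suc k))) ⟩
  ℤ→ℚ (+ (4 *ℕ (suc k *ℕ suc k))) ℚ.* κ (suc k)
    ≡⟨ n*1/n≡1 (4 *ℕ (suc k *ℕ suc k)) ⟩
  1ℚ ∎
  where open ≡-Reasoning

-- The same, with the factors of 4p² embedded separately, as needed for ring normalisation in ℚ.
4p²κ≡1′ : ∀ p .{{_ : ℕ.NonZero p}} → ℤ→ℚ (+ 4) ℚ.* (ℤ→ℚ (+ p) ℚ.* ℤ→ℚ (+ p)) ℚ.* κ p ≡ 1ℚ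
4p²κ≡1′ p = trans (cong (ℚ._* κ p) (sym (trans (ℤ→ℚ-* (+ 4) (+ p * + p)) (cong (ℤ→ℚ (+ 4) ℚ.*_) (ℤ→ℚ-* (+ p) (+ p))))))
                  (4p²κ≡1 p)

IsInt-κ : ∀ p .{{_ : ℕ.NonZero p}} {N} → + 4 * (+ p * + p) ∣ N → IsInt (ℚ.- (ℤ→ℚ N ℚ.* κ p))
IsInt-κ p (divides q refl) = - q , (begin
  ℚ.- (ℤ→ℚ (q * M) ℚ.* κ p)         ≡⟨ cong (λ t → ℚ.- (t ℚ.* κ p)) (ℤ→ℚ-* q M) ⟩
  ℚ.- (ℤ→ℚ q ℚ.* ℤ→ℚ M ℚ.* κ p)     ≡⟨ cong ℚ.-_ (ℚP.*-assoc (ℤ→ℚ q) (ℤ→ℚ M) (κ p)) ⟩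
  ℚ.- (ℤ→ℚ q ℚ.* (ℤ→ℚ M ℚ.* κ p))   ≡⟨ cong (λ t → ℚ.- (ℤ→ℚ q ℚ.* t)) (4p²κ≡1 p) ⟩
  ℚ.- (ℤ→ℚ q ℚ.* 1ℚ)                ≡⟨ cong ℚ.-_ (ℚP.*-identityʳ (ℤ→ℚ q)) ⟩
  ℚ.- ℤ→ℚ q                          ≡⟨ sym (ℤ→ℚ-neg q) ⟩
  ℤ→ℚ (- q)                          ∎)
  where
  open ≡-Reasoning
  M = + 4 * (+ p * + p)

_·ℤ_ : M2 ℤ → M2 ℤ → M2 ℤ
x ·ℤ y = mat (a x * a y + b x * c y) (a x * b y + b x * d y)
             (c x * a y + d x * c y) (c x * b y + d x * d y)

adjℤ : M2 ℤ → M2 ℤ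
adjℤ x = mat (d x) (- b x) (- c x) (a x)

_-ℤ_ : M2 ℤ → M2 ℤ → M2 ℤ
x -ℤ y = mat (a x - a y) (b x - b y) (c x - c y) (d x - d y)

cong-mat : ∀ {S : Set} {a b c d a' b' c' d' : S} →
  a ≡ a' → b ≡ b' → c ≡ c' → d ≡ d' → mat a b c d ≡ mat a' b' c' d'
cong-mat refl refl refl refl = refl

toℚM-· : ∀ m n → toℚM m · toℚM n ≡ toℚM (m ·ℤ n)
toℚM-· m n = sym (cong-mat (ℤ→ℚ-*+* (a m) (a n) (b m) (c n)) (ℤ→ℚ-*+* (a m) (b n) (b m) (d n))
                           (ℤ→ℚ-*+* (c m) (a n) (d m) (c n)) (ℤ→ℚ-*+* (c m) (b n) (d m) (d n)))

toℚM-adj : ∀ m → adj (toℚM m) ≡ toℚM (adjℤ m)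
toℚM-adj m = cong-mat refl (sym (ℤ→ℚ-neg (b m))) (sym (ℤ→ℚ-neg (c m))) refl

toℚM-⊖ : ∀ m n → toℚM m ⊖ toℚM n ≡ toℚM (m -ℤ n)
toℚM-⊖ m n = sym (cong-mat (ℤ→ℚ-sub (a m) (a n)) (ℤ→ℚ-sub (b m) (b n)) (ℤ→ℚ-sub (c m) (c n)) (ℤ→ℚ-sub (d m) (d n)))

tr-toℚM : ∀ m → tr (toℚM m) ≡ ℤ→ℚ (a m + d m)
tr-toℚM m = sym (ℤ→ℚ-+ (a m) (d m))

toℚM-injective : ∀ {m n} → toℚM m ≡ toℚM n → m ≡ n
toℚM-injective {mat _ _ _ _} {mat _ _ _ _} eq = cong-mat
  (ℤ→ℚ-injective (cong a eq)) (ℤ→ℚ-injective (cong b eq)) (ℤ→ℚ-injective (cong c eq)) (ℤ→ℚ-injective (cong d eq))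

record Coord : Set where
  constructor ⟨_,_,_⟩
  field A B C : ℤ
open Coord

embed : Coord → M2 ℚ
embed v = toℚM (Lmat (A v) (B v) (C v))

_-ᶜ_ : Coord → Coord → Coord
v -ᶜ w = ⟨ A v - A w , B v - B w , C v - C w ⟩

embed-⊖ : ∀ v w → embed v ⊖ embed w ≡ embed (v -ᶜ w)
embed-⊖ v w = trans (toℚM-⊖ (Lmat (A v) (B v) (C v)) (Lmat (A w) (B w) (C w)))
  (cong toℚM (cong-mat (refl {x = B v - B w}) (sub-2× (C v) (C w)) (sub-neg-2× (A v) (A w)) (sub-neg (B v) (B w))))
  where
  sub-2× : ∀ x y → + 2 * x - + 2 * y ≡ + 2 * (x - y)
  sub-2× = solve-∀
  sub-neg-2× : ∀ x y → - (+ 2 * x) - - (+ 2 * y) ≡ - (+ 2 * (x - y))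
  sub-neg-2× = solve-∀
  sub-neg : ∀ x y → - x - - y ≡ - (x - y)
  sub-neg = solve-∀

coord-≡ : ∀ {A B C A' B' C'} → A ≡ A' → B ≡ B' → C ≡ C' → ⟨ A , B , C ⟩ ≡ ⟨ A' , B' , C' ⟩
coord-≡ refl refl refl = refl

embed-injective : ∀ {v w} → embed v ≡ embed w → v ≡ w
embed-injective {v} {w} eq = coord-≡
  (ℤP.*-cancelˡ-≡ (+ 2) (A v) (A w) (ℤP.neg-injective (cong c Lmat≡)))
  (cong a Lmat≡)
  (ℤP.*-cancelˡ-≡ (+ 2) (C v) (C w) (cong b Lmat≡))
  where
  Lmat≡ : Lmat (A v) (B v) (C v) ≡ Lmat (A w) (B w) (C w)
  Lmat≡ = toℚM-injective {Lmat (A v) (B v) (C v)} {Lmat (A w) (B w) (C w)} eq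

record IsLns (p : ℕ) (ε : ℤ) (v : Coord) : Set where
  field
    p∣A     : + p ∣ A v
    p∣B     : + p ∣ B v
    p∣C     : + p ∣ C v
    2∣B     : + 2 ∣ B v
    p²∣A-εC : + p * + p ∣ A v - ε * C v

-- Coordinate form of membership in L ∩ M_ns (for odd p).
record IsLMns (p : ℕ) (ε : ℤ) (v : Coord) : Set where
  field
    p∣B    : + p ∣ B v
    p∣A+εC : + p ∣ A v + ε * C v

lns-intro : ∀ {p ε} v → IsLns p ε v → InLns p ε (embed v)
lns-intro {p} {ε} v h = A v , B v , C v , refl ,
  ∣0⇒mod p∣A , ∣0⇒mod p∣B , ∣0⇒mod p∣C , ∣0⇒mod 2∣B ,
  ∣⇒mod {A v} {ε * C v} {p *ℕ p} (subst (_∣ A v - ε * C v) (sym (ℤP.pos-* p p)) p²∣A-εC)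
  where open IsLns h

lns-elim : ∀ {p ε} x → InLns p ε x → ∃[ v ] x ≡ embed v × IsLns p ε v
lns-elim {p} {ε} _ (A , B , C , refl , hA , hB , hC , h2B , hAC) = ⟨ A , B , C ⟩ , refl , record
  { p∣A = mod0⇒∣ hA ; p∣B = mod0⇒∣ hB ; p∣C = mod0⇒∣ hC ; 2∣B = mod0⇒∣ h2B
  ; p²∣A-εC = subst (_∣ A - ε * C) (ℤP.pos-* p p) (mod⇒∣ {A} {ε * C} {p *ℕ p} hAC) }

lmns-intro : ∀ {p ε} v → IsLMns p ε v → InL∩Mns p ε (embed v)
lmns-intro {p} {ε} v h = A v , B v , C v , refl ,
  ∣⇒mod {B v} { - B v} {p} (subst (+ p ∣_) (twice (B v)) (∣n⇒∣m*n (+ 2) p∣B)) ,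
  ∣⇒mod {+ 2 * C v * ε} { - (+ 2 * A v)} {p} (subst (+ p ∣_) (twice-sum (A v) (C v) ε) (∣n⇒∣m*n (+ 2) p∣A+εC))
  where
  open IsLMns h
  twice : ∀ x → + 2 * x ≡ x - - x
  twice = solve-∀
  twice-sum : ∀ x z ε → + 2 * (x + ε * z) ≡ + 2 * z * ε - - (+ 2 * x)
  twice-sum = solve-∀

-- Recovering the coordinates uses that 2 is invertible modulo the odd number p.
lmns-elim : ∀ {p ε} x → Odd (+ p) → InL∩Mns p ε x → ∃[ v ] x ≡ embed v × IsLMns p ε v
lmns-elim {p} {ε} _ p-odd (A , B , C , refl , hB , hAC) = ⟨ A , B , C ⟩ , refl , record
  { p∣B    = ∣2*⇒∣ p-odd (subst (+ p ∣_) (twice⁻¹ B) (mod⇒∣ {B} { - B} {p} hB))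
  ; p∣A+εC = ∣2*⇒∣ p-odd (subst (+ p ∣_) (twice-sum⁻¹ A C ε) (mod⇒∣ {+ 2 * C * ε} { - (+ 2 * A)} {p} hAC)) }
  where
  twice⁻¹ : ∀ x → x - - x ≡ + 2 * x
  twice⁻¹ = solve-∀
  twice-sum⁻¹ : ∀ x z ε → + 2 * z * ε - - (+ 2 * x) ≡ + 2 * (x + ε * z)
  twice-sum⁻¹ = solve-∀

tr-embed : ∀ v → tr (embed v) ≡ 0ℚ
tr-embed v = trans (tr-toℚM (Lmat (A v) (B v) (C v))) (cong ℤ→ℚ (ℤP.+-inverseʳ (B v)))

β-embed : ∀ p v w → β p (embed v) (embed w)
  ≡ ℚ.- (ℤ→ℚ (+ 4 * (A v * C w + C v * A w) - + 2 * (B v * B w)) ℚ.* κ p)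
β-embed p v w = cong (λ t → ℚ.- (t ℚ.* κ p)) (begin
  tr (toℚM L · adj (toℚM L'))         ≡⟨ cong (λ y → tr (toℚM L · y)) (toℚM-adj L') ⟩
  tr (toℚM L · toℚM (adjℤ L'))        ≡⟨ cong tr (toℚM-· L (adjℤ L')) ⟩
  tr (toℚM (L ·ℤ adjℤ L'))            ≡⟨ tr-toℚM (L ·ℤ adjℤ L') ⟩
  ℤ→ℚ (a (L ·ℤ adjℤ L') + d (L ·ℤ adjℤ L')) ≡⟨ cong ℤ→ℚ (trace (A v) (B v) (C v) (A w) (B w) (C w)) ⟩
  ℤ→ℚ (+ 4 * (A v * C w + C v * A w) - + 2 * (B v * B w)) ∎)
  where
  open ≡-Reasoning
  L  = Lmat (A v) (B v) (C v)
  L' = Lmat (A w) (B w) (C w)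
  trace : ∀ A B C A' B' C' →
    B * - B' + + 2 * C * - - (+ 2 * A') + (- (+ 2 * A) * - (+ 2 * C') + - B * B')
    ≡ + 4 * (A * C' + C * A') - + 2 * (B * B')
  trace = solve-∀

β₁-embed : ∀ p .{{_ : ℕ.NonZero p}} v z →
  β₁ p (embed v) ℚ.- over4p² p z ≡ ℚ.- (ℤ→ℚ (+ 4 * A v * C v - B v * B v + z) ℚ.* κ p)
β₁-embed p v z = begin
  β p (embed v) (embed v) ℚ.* half ℚ.- over4p² p z
    ≡⟨ cong₂ (λ q t → q ℚ.* half ℚ.- t) (β-embed p v v) (over4p²≡*κ p z) ⟩
  ℚ.- (ℤ→ℚ (+ 4 * (A v * C v + C v * A v) - + 2 * (B v * B v)) ℚ.* k) ℚ.* half ℚ.- ℤ→ℚ z ℚ.* k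
    ≡⟨ cong (λ q → ℚ.- (q ℚ.* k) ℚ.* half ℚ.- ℤ→ℚ z ℚ.* k)
            (trans (cong ℤ→ℚ (double (A v) (B v) (C v))) (ℤ→ℚ-* (+ 2) M)) ⟩
  ℚ.- (ℤ→ℚ (+ 2) ℚ.* ℤ→ℚ M ℚ.* k) ℚ.* half ℚ.- ℤ→ℚ z ℚ.* k
    ≡⟨ solve 3 (λ M z k → :- (con (ℤ→ℚ (+ 2)) :* M :* k) :* con half :- z :* k := :- ((M :+ z) :* k))
         refl (ℤ→ℚ M) (ℤ→ℚ z) k ⟩
  ℚ.- ((ℤ→ℚ M ℚ.+ ℤ→ℚ z) ℚ.* k)
    ≡⟨ cong (λ q → ℚ.- (q ℚ.* k)) (sym (ℤ→ℚ-+ M z)) ⟩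
  ℚ.- (ℤ→ℚ (M + z) ℚ.* k) ∎
  where
  open ≡-Reasoning
  half = 1ℤ ℚ./ 2
  k = κ p
  M = + 4 * A v * C v - B v * B v
  double : ∀ A B C → + 4 * (A * C + C * A) - + 2 * (B * B) ≡ + 2 * (+ 4 * A * C - B * B)
  double = solve-∀

-- L ∩ M_ns pairs integrally with L_ns: this is the divisibility behind L ∩ M_ns ⊆ L_ns^∨.
lmns-lns-pairing : ∀ {p ε v w} → Odd (+ p) → IsLMns p ε v → IsLns p ε w →
  + 4 * (+ p * + p) ∣ + 4 * (A v * C w + C v * A w) - + 2 * (B v * B w)
lmns-lns-pairing {p} {ε} {v} {w} p-odd hv hw = ∣m∣n⇒∣m-n
  (*-monoʳ-∣ (+ 4) (subst (+ p * + p ∣_) (regroup (A v) (C v) (A w) (C w) ε)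
    (∣m∣n⇒∣m+n (∣-* (IsLMns.p∣A+εC hv) (IsLns.p∣C hw)) (∣n⇒∣m*n (C v) (IsLns.p²∣A-εC hw)))))
  (subst (_∣ + 2 * (B v * B w)) (reorder (+ p))
    (*-monoʳ-∣ (+ 2) (∣-* (IsLMns.p∣B hv) (2∣∧∣⇒2*∣ p-odd (IsLns.2∣B hw) (IsLns.p∣B hw)))))
  where
  regroup : ∀ A C A' C' ε → (A + ε * C) * C' + C * (A' - ε * C') ≡ A * C' + C * A'
  regroup = solve-∀
  reorder : ∀ p → + 2 * (p * (+ 2 * p)) ≡ + 4 * (p * p)
  reorder = solve-∀

lmns⇒dual : ∀ {p ε} .{{_ : ℕ.NonZero p}} → Odd (+ p) → ∀ v → IsLMns p ε v → InDual p ε (embed v)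
lmns⇒dual {p} {ε} p-odd v hv = tr-embed v , integral
  where
  integral : ∀ y → InLns p ε y → IsInt (β p (embed v) y)
  integral y y∈Lns =
    let (w , y≡w , hw) = lns-elim y y∈Lns
    in subst (λ z → IsInt (β p (embed v) z)) (sym y≡w)
         (subst IsInt (sym (β-embed p v w)) (IsInt-κ p (lmns-lns-pairing p-odd hv hw)))

β-against : ∀ p x w → β p x (embed w)
  ≡ ((a x ℚ.- d x) ℚ.* ℤ→ℚ (B w) ℚ.- ℤ→ℚ (+ 2) ℚ.* b x ℚ.* ℤ→ℚ (A w)
       ℚ.+ ℤ→ℚ (+ 2) ℚ.* c x ℚ.* ℤ→ℚ (C w)) ℚ.* κ p
β-against p x w = begin
  ℚ.- (tr (x · adj (toℚM L')) ℚ.* κ p)       ≡⟨ cong (λ y → ℚ.- (tr (x · y) ℚ.* κ p)) adj-entries ⟩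
  ℚ.- (tr (x · mat (ℚ.- B') (ℚ.- (two ℚ.* C')) (two ℚ.* A') B') ℚ.* κ p)
    ≡⟨ solve 9 (λ u v w t A' B' C' k two →
         :- (((u :* (:- B') :+ v :* (two :* A')) :+ (w :* (:- (two :* C')) :+ t :* B')) :* k)
         := ((u :- t) :* B' :- two :* v :* A' :+ two :* w :* C') :* k)
       refl (a x) (b x) (c x) (d x) A' B' C' (κ p) two ⟩
  ((a x ℚ.- d x) ℚ.* B' ℚ.- two ℚ.* b x ℚ.* A' ℚ.+ two ℚ.* c x ℚ.* C') ℚ.* κ p ∎
  where
  open ≡-Reasoning
  L' = Lmat (A w) (B w) (C w)
  A' = ℤ→ℚ (A w)
  B' = ℤ→ℚ (B w)
  C' = ℤ→ℚ (C w)
  two = ℤ→ℚ (+ 2)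
  adj-entries : adj (toℚM L') ≡ mat (ℚ.- B') (ℚ.- (two ℚ.* C')) (two ℚ.* A') B'
  adj-entries = cong-mat (ℤ→ℚ-neg (B w)) (cong ℚ.-_ (ℤ→ℚ-* (+ 2) (C w)))
    (trans (sym (ℤ→ℚ-neg (- (+ 2 * A w))))
      (trans (cong ℤ→ℚ (ℤP.neg-involutive (+ 2 * A w))) (ℤ→ℚ-* (+ 2) (A w))))
    refl

-- Three points of L_ns whose pairings determine a rational matrix in V.
probe₁ probe₂ : ℕ → Coord
probe₁ p = ⟨ 0ℤ , + 2 * + p , 0ℤ ⟩
probe₂ p = ⟨ + p * + p , 0ℤ , 0ℤ ⟩

probe₃ : ℕ → ℤ → Coord
probe₃ p ε = ⟨ ε * + p , 0ℤ , + p ⟩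

probe₁-Lns : ∀ p ε → IsLns p ε (probe₁ p)
probe₁-Lns p ε = record
  { p∣A = k∣0 ; p∣B = ∣n⇒∣m*n (+ 2) ∣-refl ; p∣C = k∣0 ; 2∣B = ∣m⇒∣m*n (+ p) ∣-refl
  ; p²∣A-εC = ∣-≡ (sym (ℤP.*-zeroʳ ε)) }

probe₂-Lns : ∀ p ε → IsLns p ε (probe₂ p)
probe₂-Lns p ε = record
  { p∣A = ∣m⇒∣m*n (+ p) ∣-refl ; p∣B = k∣0 ; p∣C = k∣0 ; 2∣B = k∣0
  ; p²∣A-εC = ∣m∣n⇒∣m-n ∣-refl (∣n⇒∣m*n ε k∣0) }

probe₃-Lns : ∀ p ε → IsLns p ε (probe₃ p ε)
probe₃-Lns p ε = record
  { p∣A = ∣n⇒∣m*n ε ∣-refl ; p∣B = k∣0 ; p∣C = ∣-refl ; 2∣B = k∣0 ; p²∣A-εC = ∣-≡ (refl {x = ε * + p}) }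

module _ (p : ℕ) (ε : ℤ) (x : M2 ℚ) where
  private
    π = ℤ→ℚ (+ p)
    e = ℤ→ℚ ε
    two = ℤ→ℚ (+ 2)
    k = κ p

  β-probe₁ : β p x (embed (probe₁ p)) ≡ two ℚ.* π ℚ.* (a x ℚ.- d x) ℚ.* k
  β-probe₁ = trans (β-against p x (probe₁ p)) (trans
    (cong (λ q → ((a x ℚ.- d x) ℚ.* q ℚ.- two ℚ.* b x ℚ.* 0ℚ ℚ.+ two ℚ.* c x ℚ.* 0ℚ) ℚ.* k) (ℤ→ℚ-* (+ 2) (+ p)))
    (solve 6 (λ u t v w π k → ((u :- t) :* (con two :* π) :- con two :* v :* con 0ℚ :+ con two :* w :* con 0ℚ) :* k
                              := con two :* π :* (u :- t) :* k) refl (a x) (d x) (b x) (c x) π k))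

  β-probe₂ : β p x (embed (probe₂ p)) ≡ ℚ.- (two ℚ.* (π ℚ.* π) ℚ.* b x ℚ.* k)
  β-probe₂ = trans (β-against p x (probe₂ p)) (trans
    (cong (λ q → ((a x ℚ.- d x) ℚ.* 0ℚ ℚ.- two ℚ.* b x ℚ.* q ℚ.+ two ℚ.* c x ℚ.* 0ℚ) ℚ.* k) (ℤ→ℚ-* (+ p) (+ p)))
    (solve 6 (λ u t v w π k → ((u :- t) :* con 0ℚ :- con two :* v :* (π :* π) :+ con two :* w :* con 0ℚ) :* k
                              := :- (con two :* (π :* π) :* v :* k)) refl (a x) (d x) (b x) (c x) π k))

  β-probe₃ : β p x (embed (probe₃ p ε)) ≡ two ℚ.* π ℚ.* (c x ℚ.- e ℚ.* b x) ℚ.* k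
  β-probe₃ = trans (β-against p x (probe₃ p ε)) (trans
    (cong (λ q → ((a x ℚ.- d x) ℚ.* 0ℚ ℚ.- two ℚ.* b x ℚ.* q ℚ.+ two ℚ.* c x ℚ.* π) ℚ.* k) (ℤ→ℚ-* ε (+ p)))
    (solve 7 (λ u t v w π e k → ((u :- t) :* con 0ℚ :- con two :* v :* (e :* π) :+ con two :* w :* π) :* k
                                := con two :* π :* (w :- e :* v) :* k) refl (a x) (d x) (b x) (c x) π e k))

-- Linear algebra behind L_ns^∨ ⊆ L ∩ M_ns: when 4π²κ = 1, a traceless (u v ; w t) is recovered
-- from its three probe pairings ζ₁, ζ₂, ζ₃.
probe-inversion : ∀ {π e k u v w t ζ₁ ζ₂ ζ₃} → let two = ℤ→ℚ (+ 2); four = ℤ→ℚ (+ 4) in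
  four ℚ.* (π ℚ.* π) ℚ.* k ≡ 1ℚ → u ℚ.+ t ≡ 0ℚ →
  two ℚ.* π ℚ.* (u ℚ.- t) ℚ.* k ≡ ζ₁ → ℚ.- (two ℚ.* (π ℚ.* π) ℚ.* v ℚ.* k) ≡ ζ₂ →
  two ℚ.* π ℚ.* (w ℚ.- e ℚ.* v) ℚ.* k ≡ ζ₃ →
  (u ≡ π ℚ.* ζ₁) × (v ≡ two ℚ.* ℚ.- ζ₂) × (w ≡ ℚ.- (two ℚ.* (e ℚ.* ζ₂ ℚ.- π ℚ.* ζ₃))) × (t ≡ ℚ.- (π ℚ.* ζ₁))
probe-inversion {π} {e} {k} {u} {v} {w} {t} {ζ₁} {ζ₂} {ζ₃} unit trace0 refl refl refl =
  u-entry , v-entry , w-entry , t-entry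
  where
  open ≡-Reasoning
  two = ℤ→ℚ (+ 2)
  four = ℤ→ℚ (+ 4)
  scale : ∀ q → q ≡ q ℚ.* (four ℚ.* (π ℚ.* π) ℚ.* k)
  scale q = trans (sym (ℚP.*-identityʳ q)) (cong (q ℚ.*_) (sym unit))
  u-entry : u ≡ π ℚ.* ζ₁
  u-entry = begin
    u                                  ≡⟨ scale u ⟩
    u ℚ.* (four ℚ.* (π ℚ.* π) ℚ.* k)  ≡⟨ solve 4 (λ u t π k → u :* (con four :* (π :* π) :* k)
      := π :* (con two :* π :* (u :- t) :* k) :+ (u :+ t) :* (con two :* (π :* π) :* k)) refl u t π k ⟩
    π ℚ.* ζ₁ ℚ.+ (u ℚ.+ t) ℚ.* (two ℚ.* (π ℚ.* π) ℚ.* k)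
      ≡⟨ cong (λ q → π ℚ.* ζ₁ ℚ.+ q ℚ.* (two ℚ.* (π ℚ.* π) ℚ.* k)) trace0 ⟩
    π ℚ.* ζ₁ ℚ.+ 0ℚ ℚ.* (two ℚ.* (π ℚ.* π) ℚ.* k)
      ≡⟨ solve 3 (λ z π k → z :+ con 0ℚ :* (con two :* (π :* π) :* k) := z) refl (π ℚ.* ζ₁) π k ⟩
    π ℚ.* ζ₁                           ∎
  v-entry : v ≡ two ℚ.* ℚ.- ζ₂
  v-entry = trans (scale v) (solve 3 (λ v π k → v :* (con four :* (π :* π) :* k)
    := con two :* (:- (:- (con two :* (π :* π) :* v :* k)))) refl v π k)
  w-entry : w ≡ ℚ.- (two ℚ.* (e ℚ.* ζ₂ ℚ.- π ℚ.* ζ₃))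
  w-entry = trans (scale w) (solve 5 (λ v w π e k → w :* (con four :* (π :* π) :* k)
    := :- (con two :* (e :* (:- (con two :* (π :* π) :* v :* k)) :- π :* (con two :* π :* (w :- e :* v) :* k))))
    refl v w π e k)
  t-entry : t ≡ ℚ.- (π ℚ.* ζ₁)
  t-entry = begin
    t                    ≡⟨ solve 2 (λ u t → t := :- u :+ (u :+ t)) refl u t ⟩
    ℚ.- u ℚ.+ (u ℚ.+ t)  ≡⟨ cong₂ (λ q r → ℚ.- q ℚ.+ r) u-entry trace0 ⟩
    ℚ.- (π ℚ.* ζ₁) ℚ.+ 0ℚ ≡⟨ ℚP.+-identityʳ (ℚ.- (π ℚ.* ζ₁)) ⟩
    ℚ.- (π ℚ.* ζ₁)       ∎

dual⇒lmns : ∀ {p ε} .{{_ : ℕ.NonZero p}} x → InDual p ε x → ∃[ v ] x ≡ embed v × IsLMns p ε v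
dual⇒lmns {p} {ε} x (trace0 , integral) =
  let (z₁ , H₁) = integral (embed (probe₁ p)) (lns-intro (probe₁ p) (probe₁-Lns p ε))
      (z₂ , H₂) = integral (embed (probe₂ p)) (lns-intro (probe₂ p) (probe₂-Lns p ε))
      (z₃ , H₃) = integral (embed (probe₃ p ε)) (lns-intro (probe₃ p ε) (probe₃-Lns p ε))
      (u≡ , v≡ , w≡ , t≡) = probe-inversion {ℤ→ℚ (+ p)} {ℤ→ℚ ε} {κ p} (4p²κ≡1′ p) trace0
                              (trans (sym (β-probe₁ p ε x)) H₁) (trans (sym (β-probe₂ p ε x)) H₂)
                              (trans (sym (β-probe₃ p ε x)) H₃)
  in ⟨ ε * z₂ - + p * z₃ , + p * z₁ , - z₂ ⟩ ,
     cong-mat (trans u≡ (sym (ℤ→ℚ-* (+ p) z₁))) (trans v≡ (sym (cast-b z₂)))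
              (trans w≡ (sym (cast-c z₂ z₃))) (trans t≡ (sym (cast-d z₁))) ,
     record { p∣B = ∣m⇒∣m*n z₁ ∣-refl
            ; p∣A+εC = subst (+ p ∣_) (sym (cancel ε (+ p) z₂ z₃)) (∣m⇒∣-m (∣n⇒∣m*n z₃ ∣-refl)) }
  where
  π = ℤ→ℚ (+ p)
  two = ℤ→ℚ (+ 2)
  cancel : ∀ ε p z₂ z₃ → ε * z₂ - p * z₃ + ε * - z₂ ≡ - (z₃ * p)
  cancel = solve-∀
  cast-b : ∀ z → ℤ→ℚ (+ 2 * - z) ≡ two ℚ.* ℚ.- ℤ→ℚ z
  cast-b z = trans (ℤ→ℚ-* (+ 2) (- z)) (cong (two ℚ.*_) (ℤ→ℚ-neg z))
  cast-c : ∀ z₂ z₃ → ℤ→ℚ (- (+ 2 * (ε * z₂ - + p * z₃)))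
                     ≡ ℚ.- (two ℚ.* (ℤ→ℚ ε ℚ.* ℤ→ℚ z₂ ℚ.- π ℚ.* ℤ→ℚ z₃))
  cast-c z₂ z₃ = trans (ℤ→ℚ-neg (+ 2 * (ε * z₂ - + p * z₃)))
    (cong ℚ.-_ (trans (ℤ→ℚ-* (+ 2) (ε * z₂ - + p * z₃)) (cong (two ℚ.*_)
      (trans (ℤ→ℚ-sub (ε * z₂) (+ p * z₃)) (cong₂ ℚ._-_ (ℤ→ℚ-* ε z₂) (ℤ→ℚ-* (+ p) z₃))))))
  cast-d : ∀ z → ℤ→ℚ (- (+ p * z)) ≡ ℚ.- (π ℚ.* ℤ→ℚ z)
  cast-d z = trans (ℤ→ℚ-neg (+ p * z)) (cong ℚ.-_ (ℤ→ℚ-* (+ p) z))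

conjᶜ : M2 ℤ → Coord → Coord
conjᶜ (mat g₁ g₂ g₃ g₄) ⟨ A , B , C ⟩ =
  ⟨ g₄ * g₄ * A + g₃ * g₃ * C - g₃ * g₄ * B
  , (g₁ * g₄ + g₂ * g₃) * B - + 2 * g₂ * g₄ * A - + 2 * g₁ * g₃ * C
  , g₁ * g₁ * C - g₁ * g₂ * B + g₂ * g₂ * A ⟩

conj-embed : ∀ γ v → conj γ (embed v) ≡ embed (conjᶜ γ v)
conj-embed γ@(mat g₁ g₂ g₃ g₄) v@(⟨ A , B , C ⟩) = begin
  (toℚM γ · toℚM L) · adj (toℚM γ)   ≡⟨ cong₂ _·_ (toℚM-· γ L) (toℚM-adj γ) ⟩
  toℚM (γ ·ℤ L) · toℚM (adjℤ γ)      ≡⟨ toℚM-· (γ ·ℤ L) (adjℤ γ) ⟩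
  toℚM ((γ ·ℤ L) ·ℤ adjℤ γ)          ≡⟨ cong toℚM (cong-mat (e₁ g₁ g₂ g₃ g₄ A B C) (e₂ g₁ g₂ g₃ g₄ A B C)
                                                           (e₃ g₁ g₂ g₃ g₄ A B C) (e₄ g₁ g₂ g₃ g₄ A B C)) ⟩
  embed (conjᶜ γ v)                  ∎
  where
  open ≡-Reasoning
  L = Lmat A B C
  e₁ : ∀ g₁ g₂ g₃ g₄ A B C → (g₁ * B + g₂ * - (+ 2 * A)) * g₄ + (g₁ * (+ 2 * C) + g₂ * - B) * - g₃
     ≡ (g₁ * g₄ + g₂ * g₃) * B - + 2 * g₂ * g₄ * A - + 2 * g₁ * g₃ * C
  e₁ = solve-∀
  e₂ : ∀ g₁ g₂ g₃ g₄ A B C → (g₁ * B + g₂ * - (+ 2 * A)) * - g₂ + (g₁ * (+ 2 * C) + g₂ * - B) * g₁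
     ≡ + 2 * (g₁ * g₁ * C - g₁ * g₂ * B + g₂ * g₂ * A)
  e₂ = solve-∀
  e₃ : ∀ g₁ g₂ g₃ g₄ A B C → (g₃ * B + g₄ * - (+ 2 * A)) * g₄ + (g₃ * (+ 2 * C) + g₄ * - B) * - g₃
     ≡ - (+ 2 * (g₄ * g₄ * A + g₃ * g₃ * C - g₃ * g₄ * B))
  e₃ = solve-∀
  e₄ : ∀ g₁ g₂ g₃ g₄ A B C → (g₃ * B + g₄ * - (+ 2 * A)) * - g₂ + (g₃ * (+ 2 * C) + g₄ * - B) * g₁
     ≡ - ((g₁ * g₄ + g₂ * g₃) * B - + 2 * g₂ * g₄ * A - + 2 * g₁ * g₃ * C)
  e₄ = solve-∀

-- Reduced modulo p, conjugation by γ = (g₁ g₂ ; g₃ g₄) respects, up to sign, the ε-structure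
-- defining M_ns; concretely these four quadratic expressions in γ vanish modulo p.
-- They are all that the invariance of L_ns and of L ∩ M_ns uses about γ.
record Normalises (p : ℕ) (ε : ℤ) (γ : M2 ℤ) : Set where
  field
    δ₁ : + p ∣ a γ * a γ - d γ * d γ
    δ₂ : + p ∣ c γ * c γ - ε * ε * (b γ * b γ)
    δ₃ : + p ∣ ε * a γ * b γ - c γ * d γ
    δ₄ : + p ∣ a γ * c γ - ε * b γ * d γ

-- Both cosets of M_ns in M_ns^+ normalise: write g₁ ≡ ±g₄ and g₂ε ≡ ±g₃ as α, ϐ ≡ 0 (mod p).
mns⁺-normalises : ∀ {p ε γ} → InMns⁺ p ε γ → Normalises p ε γ
mns⁺-normalises {p} {ε} {mat g₁ g₂ g₃ g₄} (inj₁ (h₁ , h₂)) = record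
  { δ₁ = subst (+ p ∣_) (sym (δ₁≡ g₁ g₄)) (∣n⇒∣m*n (g₁ + g₄) α)
  ; δ₂ = subst (+ p ∣_) (sym (δ₂≡ g₂ g₃ ε)) (∣n⇒∣m*n (- (g₃ + ε * g₂)) ϐ)
  ; δ₃ = subst (+ p ∣_) (sym (δ₃≡ g₁ g₂ g₃ g₄ ε)) (∣-lin (ε * g₂) g₄ α ϐ)
  ; δ₄ = subst (+ p ∣_) (sym (δ₄≡ g₁ g₂ g₃ g₄ ε)) (∣-lin (ε * g₂) (- g₁) α ϐ) }
  where
  α = mod⇒∣ {g₁} {g₄} {p} h₁
  ϐ = mod⇒∣ {g₂ * ε} {g₃} {p} h₂
  δ₁≡ : ∀ g₁ g₄ → g₁ * g₁ - g₄ * g₄ ≡ (g₁ + g₄) * (g₁ - g₄)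
  δ₁≡ = solve-∀
  δ₂≡ : ∀ g₂ g₃ ε → g₃ * g₃ - ε * ε * (g₂ * g₂) ≡ - (g₃ + ε * g₂) * (g₂ * ε - g₃)
  δ₂≡ = solve-∀
  δ₃≡ : ∀ g₁ g₂ g₃ g₄ ε → ε * g₁ * g₂ - g₃ * g₄ ≡ ε * g₂ * (g₁ - g₄) + g₄ * (g₂ * ε - g₃)
  δ₃≡ = solve-∀
  δ₄≡ : ∀ g₁ g₂ g₃ g₄ ε → g₁ * g₃ - ε * g₂ * g₄ ≡ ε * g₂ * (g₁ - g₄) + - g₁ * (g₂ * ε - g₃)
  δ₄≡ = solve-∀
mns⁺-normalises {p} {ε} {mat g₁ g₂ g₃ g₄} (inj₂ (h₁ , h₂)) = record
  { δ₁ = subst (+ p ∣_) (sym (δ₁≡ g₁ g₄)) (∣n⇒∣m*n (g₁ - g₄) α)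
  ; δ₂ = subst (+ p ∣_) (sym (δ₂≡ g₂ g₃ ε)) (∣n⇒∣m*n (g₃ - ε * g₂) ϐ)
  ; δ₃ = subst (+ p ∣_) (sym (δ₃≡ g₁ g₂ g₃ g₄ ε)) (∣-lin (ε * g₂) (- g₄) α ϐ)
  ; δ₄ = subst (+ p ∣_) (sym (δ₄≡ g₁ g₂ g₃ g₄ ε)) (∣-lin (- (ε * g₂)) g₁ α ϐ) }
  where
  α = mod⇒∣ {g₁} { - g₄} {p} h₁
  ϐ = mod⇒∣ {g₂ * ε} { - g₃} {p} h₂
  δ₁≡ : ∀ g₁ g₄ → g₁ * g₁ - g₄ * g₄ ≡ (g₁ - g₄) * (g₁ - - g₄)
  δ₁≡ = solve-∀
  δ₂≡ : ∀ g₂ g₃ ε → g₃ * g₃ - ε * ε * (g₂ * g₂) ≡ (g₃ - ε * g₂) * (g₂ * ε - - g₃)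
  δ₂≡ = solve-∀
  δ₃≡ : ∀ g₁ g₂ g₃ g₄ ε → ε * g₁ * g₂ - g₃ * g₄ ≡ ε * g₂ * (g₁ - - g₄) + - g₄ * (g₂ * ε - - g₃)
  δ₃≡ = solve-∀
  δ₄≡ : ∀ g₁ g₂ g₃ g₄ ε → g₁ * g₃ - ε * g₂ * g₄ ≡ - (ε * g₂) * (g₁ - - g₄) + g₁ * (g₂ * ε - - g₃)
  δ₄≡ = solve-∀

-- The only non-linear condition is
-- A − εC ≡ 0 (mod p²), which follows from
--   A₂ − εC₂ = (g₄² − εg₂²)(A − εC) + δ₂·C − ε·δ₁·C + δ₃·B
-- since p divides δᵢ, B and C.
lns-invariant : ∀ {p ε γ v} → Normalises p ε γ → IsLns p ε v → IsLns p ε (conjᶜ γ v)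
lns-invariant {p} {ε} {mat g₁ g₂ g₃ g₄} {⟨ A , B , C ⟩} n h = record
  { p∣A = ∣m∣n⇒∣m-n (∣-lin (g₄ * g₄) (g₃ * g₃) p∣A p∣C) (∣n⇒∣m*n (g₃ * g₄) p∣B)
  ; p∣B = ∣m∣n⇒∣m-n (∣m∣n⇒∣m-n (∣n⇒∣m*n (g₁ * g₄ + g₂ * g₃) p∣B) (∣n⇒∣m*n (+ 2 * g₂ * g₄) p∣A))
                    (∣n⇒∣m*n (+ 2 * g₁ * g₃) p∣C)
  ; p∣C = ∣m∣n⇒∣m+n (∣m∣n⇒∣m-n (∣n⇒∣m*n (g₁ * g₁) p∣C) (∣n⇒∣m*n (g₁ * g₂) p∣B)) (∣n⇒∣m*n (g₂ * g₂) p∣A)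
  ; 2∣B = ∣m∣n⇒∣m-n (∣m∣n⇒∣m-n (∣n⇒∣m*n (g₁ * g₄ + g₂ * g₃) 2∣B) (∣m⇒∣m*n A (2∣2* g₂ g₄)))
                    (∣m⇒∣m*n C (2∣2* g₁ g₃))
  ; p²∣A-εC = subst (+ p * + p ∣_) (sym (decompose g₁ g₂ g₃ g₄ A B C ε))
      (∣m∣n⇒∣m+n (∣m∣n⇒∣m-n (∣m∣n⇒∣m+n (∣n⇒∣m*n (g₄ * g₄ - ε * (g₂ * g₂)) p²∣A-εC) (∣-* δ₂ p∣C))
                            (∣n⇒∣m*n ε (∣-* δ₁ p∣C)))
                 (∣-* δ₃ p∣B)) }
  where
  open IsLns h
  open Normalises n
  2∣2* : ∀ x y → + 2 ∣ + 2 * x * y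
  2∣2* x y = ∣m⇒∣m*n y (∣m⇒∣m*n x ∣-refl)
  decompose : ∀ g₁ g₂ g₃ g₄ A B C ε →
    g₄ * g₄ * A + g₃ * g₃ * C - g₃ * g₄ * B - ε * (g₁ * g₁ * C - g₁ * g₂ * B + g₂ * g₂ * A)
    ≡ (g₄ * g₄ - ε * (g₂ * g₂)) * (A - ε * C) + (g₃ * g₃ - ε * ε * (g₂ * g₂)) * C
      - ε * ((g₁ * g₁ - g₄ * g₄) * C) + (ε * g₁ * g₂ - g₃ * g₄) * B
  decompose = solve-∀

-- Part (2): L ∩ M_ns is stable under conjugation by a normalising γ, because
--   B₂ = (g₁g₄ + g₂g₃)B − 2g₂g₄(A + εC) − 2δ₄·C,
--   A₂ + εC₂ = (g₄² + εg₂²)(A + εC) + δ₂·C + ε·δ₁·C − (g₃g₄ + εg₁g₂)B.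
lmns-invariant : ∀ {p ε γ v} → Normalises p ε γ → IsLMns p ε v → IsLMns p ε (conjᶜ γ v)
lmns-invariant {p} {ε} {mat g₁ g₂ g₃ g₄} {⟨ A , B , C ⟩} n h = record
  { p∣B = subst (+ p ∣_) (sym (B₂≡ g₁ g₂ g₃ g₄ A B C ε))
      (∣m∣n⇒∣m-n (∣m∣n⇒∣m-n (∣n⇒∣m*n (g₁ * g₄ + g₂ * g₃) p∣B) (∣n⇒∣m*n (+ 2 * g₂ * g₄) p∣A+εC))
                 (∣n⇒∣m*n (+ 2) (∣m⇒∣m*n C δ₄)))
  ; p∣A+εC = subst (+ p ∣_) (sym (A₂+εC₂≡ g₁ g₂ g₃ g₄ A B C ε))
      (∣m∣n⇒∣m-n (∣m∣n⇒∣m+n (∣m∣n⇒∣m+n (∣n⇒∣m*n (g₄ * g₄ + ε * (g₂ * g₂)) p∣A+εC) (∣m⇒∣m*n C δ₂))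
                            (∣n⇒∣m*n ε (∣m⇒∣m*n C δ₁)))
                 (∣n⇒∣m*n (g₃ * g₄ + ε * g₁ * g₂) p∣B)) }
  where
  open IsLMns h
  open Normalises n
  B₂≡ : ∀ g₁ g₂ g₃ g₄ A B C ε →
    (g₁ * g₄ + g₂ * g₃) * B - + 2 * g₂ * g₄ * A - + 2 * g₁ * g₃ * C
    ≡ (g₁ * g₄ + g₂ * g₃) * B - + 2 * g₂ * g₄ * (A + ε * C) - + 2 * ((g₁ * g₃ - ε * g₂ * g₄) * C)
  B₂≡ = solve-∀
  A₂+εC₂≡ : ∀ g₁ g₂ g₃ g₄ A B C ε →
    g₄ * g₄ * A + g₃ * g₃ * C - g₃ * g₄ * B + ε * (g₁ * g₁ * C - g₁ * g₂ * B + g₂ * g₂ * A)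
    ≡ (g₄ * g₄ + ε * (g₂ * g₂)) * (A + ε * C) + (g₃ * g₃ - ε * ε * (g₂ * g₂)) * C
      + ε * ((g₁ * g₁ - g₄ * g₄) * C) - (g₃ * g₄ + ε * g₁ * g₂) * B
  A₂+εC₂≡ = solve-∀

-- With α = g₁ − g₄, ϐ = g₂ε − g₃ and δ = det γ, every coordinate difference is a
-- combination of multiples of p (and of δ − 1 = 0), and the mod-p² condition only involves products
-- of two such multiples.
conj-moves-into-Lns : ∀ {p ε γ v} → InMns p ε γ → detℤ γ ≡ 1ℤ → IsLMns p ε v →
  IsLns p ε (conjᶜ γ v -ᶜ v)
conj-moves-into-Lns {p} {ε} {mat g₁ g₂ g₃ g₄} {⟨ A , B , C ⟩} (h₁ , h₂) det h = record
  { p∣A = subst (+ p ∣_) (sym (ΔA≡ g₁ g₂ g₃ g₄ A B C ε))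
      (∣m∣n⇒∣m-n (∣m∣n⇒∣m+n (∣m∣n⇒∣m-n (∣m∣n⇒∣m-n (∣m⇒∣m*n A δ-1) (∣m⇒∣m*n A (∣n⇒∣m*n g₄ α)))
                                       (∣m⇒∣m*n C (∣n⇒∣m*n g₃ ϐ)))
                            (∣n⇒∣m*n (g₂ * g₃) p∣A+εC))
                 (∣n⇒∣m*n (g₃ * g₄) p∣B))
  ; p∣B = p∣ΔB
  ; p∣C = subst (+ p ∣_) (sym (ΔC≡ g₁ g₂ g₃ g₄ A B C ε))
      (∣m∣n⇒∣m-n (∣m∣n⇒∣m+n (∣m∣n⇒∣m-n (∣m∣n⇒∣m+n (∣m⇒∣m*n C δ-1) (∣m⇒∣m*n C (∣n⇒∣m*n g₁ α)))
                                       (∣n⇒∣m*n (g₁ * g₂) p∣B))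
                            (∣n⇒∣m*n (g₂ * g₂) p∣A+εC))
                 (∣m⇒∣m*n C (∣n⇒∣m*n g₂ ϐ)))
  ; 2∣B = 2∣ΔB
  ; p²∣A-εC = subst (+ p * + p ∣_) (sym (ΔA-εΔC≡ g₁ g₂ g₃ g₄ A B C ε))
      (∣m∣n⇒∣m+n (∣m∣n⇒∣m+n (∣m∣n⇒∣m+n (∣m∣n⇒∣m-n (∣m∣n⇒∣m-n (∣m∣n⇒∣m-n
        (∣m⇒∣m*n (A - ε * C) δ-1)
        (∣n⇒∣m*n g₄ (∣-* α p∣A+εC)))
        (∣n⇒∣m*n ε (∣m⇒∣m*n C (∣-* α α))))
        (∣n⇒∣m*n g₂ (∣-* ϐ p∣A+εC)))
        (∣m⇒∣m*n C (∣-* ϐ ϐ)))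
        (∣n⇒∣m*n g₄ (∣-* ϐ p∣B)))
        (∣n⇒∣m*n (ε * g₂) (∣-* α p∣B))) }
  where
  open IsLMns h
  α : + p ∣ g₁ - g₄
  α = mod⇒∣ {g₁} {g₄} {p} h₁
  ϐ : + p ∣ g₂ * ε - g₃
  ϐ = mod⇒∣ {g₂ * ε} {g₃} {p} h₂
  δ-1 : ∀ {k} → k ∣ g₁ * g₄ - g₂ * g₃ - 1ℤ
  δ-1 = ∣-≡ det
  ΔA≡ : ∀ g₁ g₂ g₃ g₄ A B C ε →
    g₄ * g₄ * A + g₃ * g₃ * C - g₃ * g₄ * B - A
    ≡ (g₁ * g₄ - g₂ * g₃ - 1ℤ) * A - g₄ * (g₁ - g₄) * A - g₃ * (g₂ * ε - g₃) * C
      + g₂ * g₃ * (A + ε * C) - g₃ * g₄ * B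
  ΔA≡ = solve-∀
  ΔC≡ : ∀ g₁ g₂ g₃ g₄ A B C ε →
    g₁ * g₁ * C - g₁ * g₂ * B + g₂ * g₂ * A - C
    ≡ (g₁ * g₄ - g₂ * g₃ - 1ℤ) * C + g₁ * (g₁ - g₄) * C - g₁ * g₂ * B
      + g₂ * g₂ * (A + ε * C) - g₂ * (g₂ * ε - g₃) * C
  ΔC≡ = solve-∀
  ΔB≡ : ∀ g₁ g₂ g₃ g₄ A B C ε →
    (g₁ * g₄ + g₂ * g₃) * B - + 2 * g₂ * g₄ * A - + 2 * g₁ * g₃ * C - B
    ≡ (g₁ * g₄ - g₂ * g₃ - 1ℤ) * B + + 2 * (g₂ * g₃ * B - g₂ * g₄ * (A + ε * C)
                                           + (g₁ * (g₂ * ε - g₃) - ε * g₂ * (g₁ - g₄)) * C)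
  ΔB≡ = solve-∀
  ΔB = (g₁ * g₄ + g₂ * g₃) * B - + 2 * g₂ * g₄ * A - + 2 * g₁ * g₃ * C - B
  p∣ΔB : + p ∣ ΔB
  p∣ΔB = subst (+ p ∣_) (sym (ΔB≡ g₁ g₂ g₃ g₄ A B C ε))
    (∣m∣n⇒∣m+n (∣m⇒∣m*n B δ-1) (∣n⇒∣m*n (+ 2)
      (∣m∣n⇒∣m+n (∣m∣n⇒∣m-n (∣n⇒∣m*n (g₂ * g₃) p∣B) (∣n⇒∣m*n (g₂ * g₄) p∣A+εC))
                 (∣m⇒∣m*n C (∣m∣n⇒∣m-n (∣n⇒∣m*n g₁ ϐ) (∣n⇒∣m*n (ε * g₂) α))))))
  2∣ΔB : + 2 ∣ ΔB
  2∣ΔB = subst (+ 2 ∣_) (sym (ΔB≡ g₁ g₂ g₃ g₄ A B C ε)) (∣m∣n⇒∣m+n (∣m⇒∣m*n B δ-1) (∣m⇒∣m*n _ ∣-refl))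
  ΔA-εΔC≡ : ∀ g₁ g₂ g₃ g₄ A B C ε →
    g₄ * g₄ * A + g₃ * g₃ * C - g₃ * g₄ * B - A - ε * (g₁ * g₁ * C - g₁ * g₂ * B + g₂ * g₂ * A - C)
    ≡ (g₁ * g₄ - g₂ * g₃ - 1ℤ) * (A - ε * C) - g₄ * ((g₁ - g₄) * (A + ε * C))
      - ε * ((g₁ - g₄) * (g₁ - g₄) * C) - g₂ * ((g₂ * ε - g₃) * (A + ε * C))
      + (g₂ * ε - g₃) * (g₂ * ε - g₃) * C + g₄ * ((g₂ * ε - g₃) * B) + ε * g₂ * ((g₁ - g₄) * B)
  ΔA-εΔC≡ = solve-∀

-- Part (3): the discriminant form

-- With h = (p² + 1)/2, the
-- inverse of 2 modulo p², the map  s ↦ f s = embed ⟨ −ενs , ps , νs ⟩  with ν = ε'h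
-- identifies ℤ/2p² with L_ns^∨/L_ns and carries s²ε'/(4p²) to β₁.
module DiscriminantForm {p : ℕ} .{{_ : ℕ.NonZero p}} (r ε ε' : ℤ) (p≡2r+1 : + p ≡ + 2 * r + 1ℤ)
  (4∣ε-1 : + 4 ∣ ε - 1ℤ) (4p²∣εε'-1 : + 4 * (+ p * + p) ∣ ε * ε' - 1ℤ) where

  P = + p

  h : ℤ
  h = + 2 * r * (r + 1ℤ) + 1ℤ

  p²≡2h-1 : P * P ≡ + 2 * h - 1ℤ
  p²≡2h-1 = trans (cong (λ q → q * q) p≡2r+1) (square r)
    where
    square : ∀ r → (+ 2 * r + 1ℤ) * (+ 2 * r + 1ℤ) ≡ + 2 * (+ 2 * r * (r + 1ℤ) + 1ℤ) - 1ℤ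
    square = solve-∀

  4∣p²-1 : + 4 ∣ P * P - 1ℤ
  4∣p²-1 = divides (r * (r + 1ℤ)) (trans (cong (_- 1ℤ) p²≡2h-1) (shift r))
    where
    shift : ∀ r → + 2 * (+ 2 * r * (r + 1ℤ) + 1ℤ) - 1ℤ - 1ℤ ≡ r * (r + 1ℤ) * + 4
    shift = solve-∀

  p²∣εε'-1 : P * P ∣ ε * ε' - 1ℤ
  p²∣εε'-1 = ∣-trans (∣n⇒∣m*n (+ 4) ∣-refl) 4p²∣εε'-1

  4∣ε'-1 : + 4 ∣ ε' - 1ℤ
  4∣ε'-1 = subst (+ 4 ∣_) (split ε ε')
    (∣m∣n⇒∣m-n (∣-trans (∣m⇒∣m*n (P * P) ∣-refl) 4p²∣εε'-1) (∣m⇒∣m*n ε' 4∣ε-1))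
    where
    split : ∀ ε ε' → ε * ε' - 1ℤ - (ε - 1ℤ) * ε' ≡ ε' - 1ℤ
    split = solve-∀

  ν : ℤ
  ν = ε' * h

  fᶜ : ℤ → Coord
  fᶜ s = ⟨ - (ε * ν * s) , P * s , ν * s ⟩

  f : ℤ → M2 ℚ
  f s = embed (fᶜ s)

  -- A − εC for f s is −2εε'h·s, which is ≡ −s modulo p²: the image of s in ℤ/p² is recovered.
  A-εC-of-f : ∀ s → - (ε * ν * s) - ε * (ν * s) ≡ - (+ 2 * (ε * ε') * h * s)
  A-εC-of-f s = expand ε ε' h s
    where
    expand : ∀ ε ε' h s → - (ε * (ε' * h) * s) - ε * (ε' * h * s) ≡ - (+ 2 * (ε * ε') * h * s)
    expand = solve-∀

  f-in-LMns : ∀ s → IsLMns p ε (fᶜ s)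
  f-in-LMns s = record
    { p∣B = ∣m⇒∣m*n s ∣-refl
    ; p∣A+εC = subst (P ∣_) (sym (cancel ε ν s)) k∣0 }
    where
    cancel : ∀ ε ν s → - (ε * ν * s) + ε * (ν * s) ≡ 0ℤ
    cancel = solve-∀

  f-additive : ∀ s t → (fᶜ (s + t) -ᶜ fᶜ s) -ᶜ fᶜ t ≡ ⟨ 0ℤ , 0ℤ , 0ℤ ⟩
  f-additive s t = coord-≡ (linA ε ν s t) (linB P s t) (linB ν s t)
    where
    linA : ∀ ε ν s t → - (ε * ν * (s + t)) - - (ε * ν * s) - - (ε * ν * t) ≡ 0ℤ
    linA = solve-∀
    linB : ∀ x s t → x * (s + t) - x * s - x * t ≡ 0ℤ
    linB = solve-∀

  zero-Lns : IsLns p ε ⟨ 0ℤ , 0ℤ , 0ℤ ⟩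
  zero-Lns = record { p∣A = k∣0 ; p∣B = k∣0 ; p∣C = k∣0 ; 2∣B = k∣0 ; p²∣A-εC = ∣-≡ (sym (ℤP.*-zeroʳ ε)) }

  p-odd : Odd P
  p-odd = r , p≡2r+1

  p²∣2h-1 : P * P ∣ + 2 * h - 1ℤ
  p²∣2h-1 = ∣-reflexive p²≡2h-1

  p∣p² : P ∣ P * P
  p∣p² = ∣m⇒∣m*n P ∣-refl

  f-kernel⇒ : ∀ s → IsLns p ε (fᶜ s) → + 2 * (P * P) ∣ s
  f-kernel⇒ s hs = 2∣∧∣⇒2*∣ (odd² p-odd) (2∣*⇒2∣ p-odd 2∣B) p²∣s
    where
    open IsLns hs
    p²∣s : P * P ∣ s
    p²∣s = subst (P * P ∣_) (recover ε ε' h s)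
      (∣m∣n⇒∣m-n (∣m∣n⇒∣m-n (∣m⇒∣-m (subst (P * P ∣_) (A-εC-of-f s) p²∣A-εC))
                            (∣m⇒∣m*n (+ 2 * h * s) p²∣εε'-1))
                 (∣m⇒∣m*n s p²∣2h-1))
      where
      recover : ∀ ε ε' h s →
        - - (+ 2 * (ε * ε') * h * s) - (ε * ε' - 1ℤ) * (+ 2 * h * s) - (+ 2 * h - 1ℤ) * s ≡ s
      recover = solve-∀

  f-kernel⇐ : ∀ s → + 2 * (P * P) ∣ s → IsLns p ε (fᶜ s)
  f-kernel⇐ s 2p²∣s = record
    { p∣A = ∣m⇒∣-m (∣n⇒∣m*n (ε * ν) p∣s)
    ; p∣B = ∣n⇒∣m*n P p∣s
    ; p∣C = ∣n⇒∣m*n ν p∣s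
    ; 2∣B = ∣n⇒∣m*n P (∣-trans (∣m⇒∣m*n (P * P) ∣-refl) 2p²∣s)
    ; p²∣A-εC = subst (P * P ∣_) (sym (A-εC-of-f s))
        (∣m⇒∣-m (∣n⇒∣m*n (+ 2 * (ε * ε') * h) (∣-trans (∣n⇒∣m*n (+ 2) ∣-refl) 2p²∣s))) }
    where
    p∣s : P ∣ s
    p∣s = ∣-trans (∣n⇒∣m*n (+ 2) p∣p²) 2p²∣s

  -- Every class of L_ns^∨ = L ∩ M_ns modulo L_ns is hit: writing B = bp, the parameter
  -- s = (εC − A) + p²(b − (εC − A)) is ≡ εC − A (mod p²) and ≡ b (mod 2).
  f-onto : ∀ v → IsLMns p ε v → ∃[ s ] IsLns p ε (v -ᶜ fᶜ s)
  f-onto ⟨ A , B , C ⟩ hv with IsLMns.p∣B hv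
  ... | divides b refl = s , record
    { p∣A = subst (P ∣_) (regroup A C ε ν s) (∣m∣n⇒∣m+n (∣-trans p∣p² p²∣ΔA-εΔC) (∣n⇒∣m*n ε p∣ΔC))
    ; p∣B = ∣m∣n⇒∣m-n (∣n⇒∣m*n b ∣-refl) (∣m⇒∣m*n s ∣-refl)
    ; p∣C = p∣ΔC
    ; 2∣B = subst (+ 2 ∣_) (sym (ΔB≡ A C b ε P)) (∣m⇒∣-m (∣n⇒∣m*n P (∣m⇒∣m*n m 2∣p²-1)))
    ; p²∣A-εC = p²∣ΔA-εΔC }
    where
    open IsLMns hv using (p∣A+εC)
    m = b - (ε * C - A)
    s = (ε * C - A) + P * P * m
    2∣p²-1 : + 2 ∣ P * P - 1ℤ
    2∣p²-1 = ∣-trans (divides (+ 2) refl) 4∣p²-1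
    ΔB≡ : ∀ A C b ε P → b * P - P * ((ε * C - A) + P * P * (b - (ε * C - A)))
                        ≡ - (P * ((P * P - 1ℤ) * (b - (ε * C - A))))
    ΔB≡ = solve-∀
    ΔA-εΔC≡ : ∀ A C ε ε' h s → A - - (ε * (ε' * h) * s) - ε * (C - ε' * h * s)
                              ≡ (A - ε * C + s) + (ε * ε' - 1ℤ) * (+ 2 * h * s) + (+ 2 * h - 1ℤ) * s
    ΔA-εΔC≡ = solve-∀
    A-εC+s≡ : ∀ A C ε Q m → A - ε * C + ((ε * C - A) + Q * m) ≡ Q * m
    A-εC+s≡ = solve-∀
    p²∣ΔA-εΔC : P * P ∣ A - - (ε * ν * s) - ε * (C - ν * s)
    p²∣ΔA-εΔC = subst (P * P ∣_) (sym (ΔA-εΔC≡ A C ε ε' h s))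
      (∣m∣n⇒∣m+n (∣m∣n⇒∣m+n (subst (P * P ∣_) (sym (A-εC+s≡ A C ε (P * P) m)) (∣m⇒∣m*n m ∣-refl))
                            (∣m⇒∣m*n (+ 2 * h * s) p²∣εε'-1))
                 (∣m⇒∣m*n s p²∣2h-1))
    -- C − νs = −(2h − 1)C − (εε' − 1)·2hC + ε'h(A + εC) − ε'h·p²m, using εC − A = 2εC − (A + εC)
    ΔC≡ : ∀ A C ε ε' h Q m → C - ε' * h * ((ε * C - A) + Q * m)
          ≡ - ((+ 2 * h - 1ℤ) * C) - (ε * ε' - 1ℤ) * (+ 2 * h * C) + ε' * h * (A + ε * C) - ε' * h * (Q * m)
    ΔC≡ = solve-∀
    p∣ΔC : P ∣ C - ν * s
    p∣ΔC = subst (P ∣_) (sym (ΔC≡ A C ε ε' h (P * P) m))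
      (∣m∣n⇒∣m-n (∣m∣n⇒∣m+n (∣m∣n⇒∣m-n (∣m⇒∣-m (∣m⇒∣m*n C (∣-trans p∣p² p²∣2h-1)))
                                      (∣m⇒∣m*n (+ 2 * h * C) (∣-trans p∣p² p²∣εε'-1)))
                           (∣n⇒∣m*n (ε' * h) p∣A+εC))
                 (∣n⇒∣m*n (ε' * h) (∣m⇒∣m*n m p∣p²)))
    regroup : ∀ A C ε ν s → A - - (ε * ν * s) - ε * (C - ν * s) + ε * (C - ν * s) ≡ A - - (ε * ν * s)
    regroup = solve-∀

  -- β₁(f s) ≡ ε's²/(4p²) modulo ℤ: the numerator difference is
  --   4AC − B² + ε's² = −s²((εε' − 1)·4ε'h² + p²(ε'(p² + 2) + 1)),
  -- and 4 ∣ ε'(p² + 2) + 1 because ε' ≡ 1 and p² ≡ 1 (mod 4).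
  f-quadratic : ∀ s → IsInt (β₁ p (f s) ℚ.- over4p² p (ε' * s * s))
  f-quadratic s = subst IsInt (sym (β₁-embed p (fᶜ s) (ε' * s * s))) (IsInt-κ p 4p²∣N)
    where
    X = ε' * (P * P + + 2) + 1ℤ
    4∣X : + 4 ∣ X
    4∣X = subst (+ 4 ∣_) (split ε' (P * P))
      (∣m∣n⇒∣m+n (∣m∣n⇒∣m+n (∣m⇒∣m*n (P * P + + 2) 4∣ε'-1) 4∣p²-1) ∣-refl)
      where
      split : ∀ ε' Q → (ε' - 1ℤ) * (Q + + 2) + (Q - 1ℤ) + + 4 ≡ ε' * (Q + + 2) + 1ℤ
      split = solve-∀
    numerator : ∀ P r ε ε' s → P ≡ + 2 * r + 1ℤ →
      + 4 * - (ε * (ε' * (+ 2 * r * (r + 1ℤ) + 1ℤ)) * s) * (ε' * (+ 2 * r * (r + 1ℤ) + 1ℤ) * s)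
        - P * s * (P * s) + ε' * s * s
      ≡ - (s * s * ((ε * ε' - 1ℤ) * (+ 4 * ε' * (+ 2 * r * (r + 1ℤ) + 1ℤ) * (+ 2 * r * (r + 1ℤ) + 1ℤ))
                    + P * P * (ε' * (P * P + + 2) + 1ℤ)))
    numerator .(+ 2 * r + 1ℤ) r ε ε' s refl = expand r ε ε' s
      where
      expand : ∀ r ε ε' s →
        + 4 * - (ε * (ε' * (+ 2 * r * (r + 1ℤ) + 1ℤ)) * s) * (ε' * (+ 2 * r * (r + 1ℤ) + 1ℤ) * s)
          - (+ 2 * r + 1ℤ) * s * ((+ 2 * r + 1ℤ) * s) + ε' * s * s
        ≡ - (s * s * ((ε * ε' - 1ℤ) * (+ 4 * ε' * (+ 2 * r * (r + 1ℤ) + 1ℤ) * (+ 2 * r * (r + 1ℤ) + 1ℤ))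
                      + (+ 2 * r + 1ℤ) * (+ 2 * r + 1ℤ) * (ε' * ((+ 2 * r + 1ℤ) * (+ 2 * r + 1ℤ) + + 2) + 1ℤ)))
      expand = solve-∀
    4p²∣N : + 4 * (P * P) ∣ + 4 * - (ε * ν * s) * (ν * s) - P * s * (P * s) + ε' * s * s
    4p²∣N = subst (+ 4 * (P * P) ∣_) (sym (numerator P r ε ε' s p≡2r+1))
      (∣m⇒∣-m (∣n⇒∣m*n (s * s) (∣m∣n⇒∣m+n (∣m⇒∣m*n (+ 4 * ε' * h * h) 4p²∣εε'-1)
        (subst (_∣ P * P * X) (ℤP.*-comm (P * P) (+ 4)) (∣-* (∣-refl {P * P}) 4∣X)))))

  -- The five properties of f making it an isomorphism ℤ/2p² ≅ (L_ns^∨/L_ns, β₁ mod ℤ).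
  discriminant-form : Σ (ℤ → M2 ℚ) λ f → ((∀ s → InDual p ε (f s))
    × (∀ s t → InLns p ε ((f (s + t) ⊖ f s) ⊖ f t))
    × (∀ s → InLns p ε (f s) ⇔ (s ≡ 0ℤ [mod (2 *ℕ (p *ℕ p)) ]))
    × (∀ x → InDual p ε x → ∃[ s ] InLns p ε (x ⊖ f s))
    × (∀ s → IsInt (β₁ p (f s) -ℚ over4p² p (ε' * s * s))))
  discriminant-form = f , (λ s → lmns⇒dual p-odd (fᶜ s) (f-in-LMns s)) , additive ,
    (λ s → mk⇔ (kernel⇒ s) (kernel⇐ s)) , onto , f-quadratic
    where
    2p² : + (2 *ℕ (p *ℕ p)) ≡ + 2 * (P * P)
    2p² = trans (ℤP.pos-* 2 (p *ℕ p)) (cong (+ 2 *_) (ℤP.pos-* p p))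
    additive : ∀ s t → InLns p ε ((f (s + t) ⊖ f s) ⊖ f t)
    additive s t = subst (InLns p ε)
      (sym (trans (cong (_⊖ f t) (embed-⊖ (fᶜ (s + t)) (fᶜ s))) (trans (embed-⊖ (fᶜ (s + t) -ᶜ fᶜ s) (fᶜ t)) (cong embed (f-additive s t)))))
      (lns-intro ⟨ 0ℤ , 0ℤ , 0ℤ ⟩ zero-Lns)
    kernel⇒ : ∀ s → InLns p ε (f s) → s ≡ 0ℤ [mod (2 *ℕ (p *ℕ p)) ]
    kernel⇒ s fs∈Lns =
      let (w , fs≡w , hw) = lns-elim (f s) fs∈Lns
      in ∣0⇒mod (subst (_∣ s) (sym 2p²) (f-kernel⇒ s (subst (IsLns p ε) (sym (embed-injective fs≡w)) hw)))
    kernel⇐ : ∀ s → s ≡ 0ℤ [mod (2 *ℕ (p *ℕ p)) ] → InLns p ε (f s)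
    kernel⇐ s s≡0 = lns-intro (fᶜ s) (f-kernel⇐ s (subst (_∣ s) 2p² (mod0⇒∣ s≡0)))
    onto : ∀ x → InDual p ε x → ∃[ s ] InLns p ε (x ⊖ f s)
    onto x x∈dual =
      let (v , x≡v , hv) = dual⇒lmns x x∈dual
          (s , hs) = f-onto v hv
      in s , subst (λ y → InLns p ε (y ⊖ f s)) (sym x≡v)
               (subst (InLns p ε) (sym (embed-⊖ v (fᶜ s))) (lns-intro (v -ᶜ fᶜ s) hs))

dual⇔L∩Mns : ∀ {p ε} .{{_ : ℕ.NonZero p}} → Odd (+ p) → (x : M2 ℚ) → InDual p ε x ⇔ InL∩Mns p ε x
dual⇔L∩Mns {p} {ε} p-odd x = mk⇔ to from
  where
  to : InDual p ε x → InL∩Mns p ε x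
  to x∈dual = let (v , x≡v , hv) = dual⇒lmns x x∈dual
              in subst (InL∩Mns p ε) (sym x≡v) (lmns-intro v hv)
  from : InL∩Mns p ε x → InDual p ε x
  from x∈LMns = let (v , x≡v , hv) = lmns-elim x p-odd x∈LMns
                in subst (InDual p ε) (sym x≡v) (lmns⇒dual p-odd v hv)

Lns-conj-stable : ∀ {p ε} (γ : M2 ℤ) → InΓns⁺ p ε γ → (x : M2 ℚ) → InLns p ε x → InLns p ε (conj γ x)
Lns-conj-stable {p} {ε} γ (γ∈Mns⁺ , _) x x∈Lns =
  let (v , x≡v , hv) = lns-elim x x∈Lns
  in subst (λ y → InLns p ε (conj γ y)) (sym x≡v)
       (subst (InLns p ε) (sym (conj-embed γ v)) (lns-intro (conjᶜ γ v) (lns-invariant {p} {ε} {γ} {v} (mns⁺-normalises {p} {ε} {γ} γ∈Mns⁺) hv)))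

dual-conj-stable : ∀ {p ε} .{{_ : ℕ.NonZero p}} → Odd (+ p) →
  (γ : M2 ℤ) → InΓns⁺ p ε γ → (x : M2 ℚ) → InDual p ε x → InDual p ε (conj γ x)
dual-conj-stable {p} {ε} p-odd γ (γ∈Mns⁺ , _) x x∈dual =
  let (v , x≡v , hv) = dual⇒lmns x x∈dual
  in subst (λ y → InDual p ε (conj γ y)) (sym x≡v)
       (subst (InDual p ε) (sym (conj-embed γ v))
         (lmns⇒dual p-odd (conjᶜ γ v) (lmns-invariant {p} {ε} {γ} {v} (mns⁺-normalises {p} {ε} {γ} γ∈Mns⁺) hv)))

Γns-acts-trivially : ∀ {p ε} .{{_ : ℕ.NonZero p}} →
  (γ : M2 ℤ) → InΓns p ε γ → (x : M2 ℚ) → InDual p ε x → InLns p ε (conj γ x ⊖ x)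
Γns-acts-trivially {p} {ε} γ (γ∈Mns , det≡1) x x∈dual =
  let (v , x≡v , hv) = dual⇒lmns x x∈dual
  in subst (λ y → InLns p ε (conj γ y ⊖ y)) (sym x≡v)
       (subst (InLns p ε) (sym (trans (cong (_⊖ embed v) (conj-embed γ v)) (embed-⊖ (conjᶜ γ v) v)))
         (lns-intro (conjᶜ γ v -ᶜ v) (conj-moves-into-Lns {p} {ε} {γ} {v} γ∈Mns det≡1 hv)))

proposition9p1 : (p : ℕ) → Prime p → p ≢ 2 → (ε : ℤ)
    → ¬ (∃[ t ] (t * t ≡ ε [mod p ])) → ε ≡ 1ℤ [mod 4 ]
    → ((x : M2 ℚ) → InDual p ε x ⇔ InL∩Mns p ε x)
      × ((γ : M2 ℤ) → InΓns⁺ p ε γ → (x : M2 ℚ) → InLns p ε x → InLns p ε (conj γ x))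
      × ((γ : M2 ℤ) → InΓns⁺ p ε γ → (x : M2 ℚ) → InDual p ε x → InDual p ε (conj γ x))
      × ((γ : M2 ℤ) → InΓns p ε γ → (x : M2 ℚ) → InDual p ε x → InLns p ε (conj γ x ⊖ x))
      × ((ε' : ℤ) → ε * ε' ≡ 1ℤ [mod (4 *ℕ (p *ℕ p)) ]
         → Σ (ℤ → M2 ℚ) λ f → ((∀ s → InDual p ε (f s))
                  × (∀ s t → InLns p ε ((f (s + t) ⊖ f s) ⊖ f t))
                  × (∀ s → InLns p ε (f s) ⇔ (s ≡ 0ℤ [mod (2 *ℕ (p *ℕ p)) ]))
                  × (∀ x → InDual p ε x → ∃[ s ] InLns p ε (x ⊖ f s))
                  × (∀ s → IsInt (β₁ p (f s) -ℚ over4p² p (ε' * s * s)))))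
proposition9p1 p p-prime p≢2 ε _ ε≡1 =
  dual⇔L∩Mns p-odd , Lns-conj-stable , dual-conj-stable p-odd , Γns-acts-trivially ,
  λ ε' εε'≡1 → DiscriminantForm.discriminant-form (proj₁ p-odd) ε ε' (proj₂ p-odd)
                 (mod⇒∣ {ε} {1ℤ} {4} ε≡1) (subst (_∣ ε * ε' - 1ℤ) 4p² (mod⇒∣ {ε * ε'} {1ℤ} {4 *ℕ (p *ℕ p)} εε'≡1))
  where
  instance
    p≢0 : ℕ.NonZero p
    p≢0 = Primality.prime⇒nonZero p-prime
  p-odd : Odd (+ p)
  p-odd = oddPrime⇒odd p-prime p≢2
  4p² : + (4 *ℕ (p *ℕ p)) ≡ + 4 * (+ p * + p)
  4p² = trans (ℤP.pos-* 4 (p *ℕ p)) (cong (+ 4 *_) (ℤP.pos-* p p))
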